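{- If $M$ is a multisymmetric matroid, then the geometric flats of $M$ form a sublattice of the lattice of flats $\mathcal L_M$ (i.e., the set of geometric flats is closed under the join $F\vee G=\mathrm{cl}_M(F\cup G)$ and the meet $F\wedge G=F\cap G$).
   Context: All matroids are loopless. Flats of a matroid $M$ are subsets maximal among sets of their rank; they form a lattice $\mathcal L_M$ under inclusion; $\mathrm{cl}_M(S)$ is the smallest flat containing $S$. A multisymmetric matroid is a matroid $M$ on $\widetilde E$ with a partition $\widetilde E=\widetilde E_1\sqcup\cdots\sqcup\widetilde E_n$ such that $\Gamma=\mathfrak S_{\widetilde E_1}\times\cdots\times\mathfrak S_{\widetilde E_n}$ maps flats to flats. A subset $S$ is geometric if $S=\bigcap_{\gamma\in\Gamma}\gamma\cdot S$. -}

module Defs where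

open import Data.Nat using (ℕ; _+_; _≤_)
open import Data.Fin using (Fin)
open import Data.Fin.Subset using (Subset; _∈_; _∉_; _⊆_; _∪_; _∩_; ⁅_⁆; ∣_∣)
open import Data.Fin.Permutation using (Permutation′; _⟨$⟩ʳ_; _⟨$⟩ˡ_)
open import Data.Vec using (tabulate; lookup)
open import Data.Product using (_×_)
open import Relation.Binary.PropositionalEquality using (_≡_)
open import Relation.Nullary using (¬_)

record Matroid (m : ℕ) : Set where
  field
    rank        : Subset m → ℕ
    rank-bound  : ∀ S → rank S ≤ ∣ S ∣
    rank-mono   : ∀ S T → S ⊆ T → rank S ≤ rank T
    rank-submod : ∀ S T → rank (S ∪ T) + rank (S ∩ T) ≤ rank S + rank T

Loopless : ∀ {m} → Matroid m → Set
Loopless M = ∀ e → Matroid.rank M ⁅ e ⁆ ≡ 1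

IsFlat : ∀ {m} → Matroid m → Subset m → Set
IsFlat M F = ∀ e → e ∉ F → ¬ (Matroid.rank M (F ∪ ⁅ e ⁆) ≡ Matroid.rank M F)

IsClosureOf : ∀ {m} → Matroid m → Subset m → Subset m → Set
IsClosureOf M S C = IsFlat M C × S ⊆ C × (∀ F → IsFlat M F → S ⊆ F → C ⊆ F)

-- The partition of the ground set into blocks E₁ ⊔ ... ⊔ Eₙ is given by a
-- block-labelling function blk : Fin m → Fin n.  Γ = 𝔖_{E₁} × ... × 𝔖_{Eₙ}
-- consists of the permutations of the ground set preserving every block.
InΓ : ∀ {m n} → (Fin m → Fin n) → Permutation′ m → Set
InΓ blk γ = ∀ e → blk (γ ⟨$⟩ʳ e) ≡ blk e

-- γ · S = { γ e | e ∈ S }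
_·_ : ∀ {m} → Permutation′ m → Subset m → Subset m
γ · S = tabulate (λ e → lookup S (γ ⟨$⟩ˡ e))

IsMultisymmetric : ∀ {m n} → Matroid m → (Fin m → Fin n) → Set
IsMultisymmetric M blk = ∀ γ → InΓ blk γ → ∀ F → IsFlat M F → IsFlat M (γ · F)

IsGeometric : ∀ {m n} → (Fin m → Fin n) → Subset m → Set
IsGeometric blk S = ∀ e → (e ∈ S → (∀ γ → InΓ blk γ → e ∈ γ · S))
                        × ((∀ γ → InΓ blk γ → e ∈ γ · S) → e ∈ S)

{-# OPTIONS --safe #-}
module Submission where

-- A set S is geometric exactly when γ⁻¹ maps S into S for every γ ∈ Γ.
-- Such Γ-invariant sets are clearly closed under ∪ and ∩, which settles the
-- meet.  For the join, if S is invariant and J = cl(S), then for γ ∈ Γ the set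
-- γ · J is a flat (multisymmetry) containing γ · S ⊇ S, so J ⊆ γ · J by
-- minimality of the closure; that is, J is invariant again.

open import Defs
open import Data.Nat using (ℕ)
open import Data.Fin using (Fin)
open import Data.Fin.Subset using (Subset; _∈_; _⊆_; _∪_; _∩_)
open import Data.Fin.Subset.Properties using (x∈p∩q⁺; x∈p∩q⁻; x∈p∪q⁺; x∈p∪q⁻)
open import Data.Fin.Permutation using (Permutation′; _⟨$⟩ˡ_)
import Data.Fin.Permutation as Permutation
open import Data.Vec using (lookup)
open import Data.Vec.Properties using ([]=⇒lookup; lookup⇒[]=; lookup∘tabulate)
open import Data.Product using (_×_; _,_; proj₁)
open import Data.Sum using (inj₁; inj₂)
open import Relation.Binary.PropositionalEquality using (refl; trans; sym)

module _ {m : ℕ} where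

  ∈-·⁺ : ∀ (γ : Permutation′ m) S {e} → γ ⟨$⟩ˡ e ∈ S → e ∈ γ · S
  ∈-·⁺ γ S {e} e∈ = lookup⇒[]= e (γ · S) (trans (lookup∘tabulate _ e) ([]=⇒lookup e∈))

  ∈-·⁻ : ∀ (γ : Permutation′ m) S {e} → e ∈ γ · S → γ ⟨$⟩ˡ e ∈ S
  ∈-·⁻ γ S {e} e∈ =
    lookup⇒[]= (γ ⟨$⟩ˡ e) S (trans (sym (lookup∘tabulate (λ x → lookup S (γ ⟨$⟩ˡ x)) e)) ([]=⇒lookup e∈))

  ·-mono : ∀ (γ : Permutation′ m) {S T} → S ⊆ T → γ · S ⊆ γ · T
  ·-mono γ {S} {T} S⊆T e∈ = ∈-·⁺ γ T (S⊆T (∈-·⁻ γ S e∈))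

  module _ {n : ℕ} (blk : Fin m → Fin n) where

    ΓInvariant : Subset m → Set
    ΓInvariant S = ∀ γ → InΓ blk γ → ∀ {e} → e ∈ S → γ ⟨$⟩ˡ e ∈ S

    invariant⇒⊆· : ∀ {S} → ΓInvariant S → ∀ γ → InΓ blk γ → S ⊆ γ · S
    invariant⇒⊆· {S} inv γ γ∈Γ e∈ = ∈-·⁺ γ S (inv γ γ∈Γ e∈)

    invariant⇒geometric : ∀ {S} → ΓInvariant S → IsGeometric blk S
    invariant⇒geometric {S} inv e =
        (λ e∈ γ γ∈Γ → invariant⇒⊆· inv γ γ∈Γ e∈)
      , (λ e∈⋂ → ∈-·⁻ Permutation.id S (e∈⋂ Permutation.id (λ _ → refl)))

    geometric⇒invariant : ∀ {S} → IsGeometric blk S → ΓInvariant S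
    geometric⇒invariant {S} geo γ γ∈Γ {e} e∈ = ∈-·⁻ γ S (proj₁ (geo e) e∈ γ γ∈Γ)

    ∪-invariant : ∀ {S T} → ΓInvariant S → ΓInvariant T → ΓInvariant (S ∪ T)
    ∪-invariant {S} {T} invS invT γ γ∈Γ e∈ with x∈p∪q⁻ S T e∈
    ... | inj₁ e∈S = x∈p∪q⁺ (inj₁ (invS γ γ∈Γ e∈S))
    ... | inj₂ e∈T = x∈p∪q⁺ (inj₂ (invT γ γ∈Γ e∈T))

    ∩-invariant : ∀ {S T} → ΓInvariant S → ΓInvariant T → ΓInvariant (S ∩ T)
    ∩-invariant {S} {T} invS invT γ γ∈Γ e∈ =
      let e∈S , e∈T = x∈p∩q⁻ S T e∈ in x∈p∩q⁺ (invS γ γ∈Γ e∈S , invT γ γ∈Γ e∈T)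

    closure-invariant : ∀ (M : Matroid m) → IsMultisymmetric M blk →
      ∀ {S J} → ΓInvariant S → IsClosureOf M S J → ΓInvariant J
    closure-invariant M multisym {S} {J} invS (flatJ , S⊆J , J-least) γ γ∈Γ e∈J =
      ∈-·⁻ γ J (J-least (γ · J) (multisym γ γ∈Γ J flatJ) S⊆γ·J e∈J)
      where
      S⊆γ·J : S ⊆ γ · J
      S⊆γ·J e∈S = ·-mono γ S⊆J (invariant⇒⊆· invS γ γ∈Γ e∈S)

corollary2p6 : ∀ {m n} (M : Matroid m) (blk : Fin m → Fin n) →
    Loopless M → IsMultisymmetric M blk →
    ∀ F G → IsFlat M F → IsGeometric blk F → IsFlat M G → IsGeometric blk G →
    (∀ J → IsClosureOf M (F ∪ G) J → IsGeometric blk J)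
    × IsGeometric blk (F ∩ G)
corollary2p6 M blk _ multisym F G _ geoF _ geoG =
    (λ J closure → invariant⇒geometric blk (closure-invariant blk M multisym invF∪G closure))
  , invariant⇒geometric blk (∩-invariant blk invF invG)
  where
  invF : ΓInvariant blk F
  invF = geometric⇒invariant blk geoF
  invG : ΓInvariant blk G
  invG = geometric⇒invariant blk geoG
  invF∪G : ΓInvariant blk (F ∪ G)
  invF∪G = ∪-invariant blk invF invG
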